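{- Let $T$ be a tree with a 2SUIG representation. If two adjacent red vertices of $T$ both have degree $4$, then their squares intersect different stab lines.
   Context: Fix a constant $\epsilon\in(0,1)$. A 2SUIG representation of a graph assigns to each vertex $v$ a closed axis-parallel unit square $s_v$ intersecting one of the stab lines $y=1$ or $y=2+\epsilon$, such that $uv$ is an edge iff $u\ne v$ and $s_u\cap s_v\neq\emptyset$. A branch vertex has degree $>2$; a claw is $K_{1,3}$; a red edge of a tree $T$ is an edge $e$ such that each component of $T\setminus\{e\}$ contains a claw. Extended red path: if the red edges induce a path $P$, add to $P$, at each endpoint of $P$ of degree two in $T$, the other edge of $T$ at that endpoint. If $T$ has no red edge, fix a vertex $v$ whose closed neighbourhood contains all branch vertices; the extended red path is $uvw$ if $v$ has degree two with neighbours $u,w$, and $v$ alone otherwise. Red vertices are the vertices of the extended red path.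
   Formalization: Only 2SUIG representations whose squares have rational corner coordinates are treated, and the constant $\epsilon$ ranges over the rationals in (0,1). -}

module Defs where

open import Data.Nat using (ℕ; zero; suc; _+_; _>_)
open import Data.Bool using (Bool; true; false; if_then_else_)
open import Data.Fin using (Fin; zero; suc; inject₁; fromℕ)
open import Data.List using (List; map; allFin)
open import Data.Nat.ListAction using (sum)
open import Data.Product using (Σ; ∃; ∃-syntax; _×_; _,_)
open import Data.Sum using (_⊎_)
open import Relation.Nullary using (¬_)
open import Relation.Binary.PropositionalEquality using (_≡_; _≢_)
open import Function.Definitions using (Injective)
open import Data.Rational using (ℚ; 0ℚ; 1ℚ; _≤_; _<_) renaming (_+_ to _+ℚ_)

Graph : ℕ → Set
Graph n = Fin n → Fin n → Bool

module _ {n : ℕ} (E : Graph n) where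

  Adj : Fin n → Fin n → Set
  Adj u v = E u v ≡ true

  deg : Fin n → ℕ
  deg v = sum (map (λ u → if E v u then 1 else 0) (allFin n))

  data Reach (R : Fin n → Fin n → Set) : Fin n → Fin n → Set where
    here : ∀ {x} → Reach R x x
    step : ∀ {x y z} → R x y → Reach R y z → Reach R x z

  Connected : Set
  Connected = ∀ u v → Reach Adj u v

  Cycle : Set
  Cycle = Σ ℕ λ m → Σ (Fin (suc (suc (suc m))) → Fin n) λ c →
            Injective _≡_ _≡_ c
          × (∀ (i : Fin (suc (suc m))) → Adj (c (inject₁ i)) (c (suc i)))
          × Adj (c (fromℕ (suc (suc m)))) (c zero)

  IsTree : Set
  IsTree = Connected × ¬ Cycle

  AdjMinus : Fin n → Fin n → Fin n → Fin n → Set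
  AdjMinus u v x y = Adj x y × ¬ ((x ≡ u × y ≡ v) ⊎ (x ≡ v × y ≡ u))

  -- the component of T ∖ {uv} containing w (as a predicate on vertices)
  -- contains a claw K_{1,3}
  ComponentHasClaw : Fin n → Fin n → Fin n → Set
  ComponentHasClaw u v w =
    ∃[ c ] ∃[ a₁ ] ∃[ a₂ ] ∃[ a₃ ]
      Reach (AdjMinus u v) w c
      × a₁ ≢ a₂ × a₁ ≢ a₃ × a₂ ≢ a₃
      × AdjMinus u v c a₁ × AdjMinus u v c a₂ × AdjMinus u v c a₃

  RedEdge : Fin n → Fin n → Set
  RedEdge u v = Adj u v × ComponentHasClaw u v u × ComponentHasClaw u v v

  NoRedEdge : Set
  NoRedEdge = ∀ u v → ¬ RedEdge u v

  -- p : Fin (m+2) → Fin n is a path (m+1 ≥ 1 edges) whose edge set is exactly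
  -- the set of red edges
  RedPath : (m : ℕ) → (Fin (suc (suc m)) → Fin n) → Set
  RedPath m p = Injective _≡_ _≡_ p
              × (∀ x y → RedEdge x y →
                   ∃[ i ] ((x ≡ p (inject₁ i) × y ≡ p (suc i))
                          ⊎ (y ≡ p (inject₁ i) × x ≡ p (suc i))))
              × (∀ (i : Fin (suc m)) → RedEdge (p (inject₁ i)) (p (suc i)))

  OnExtendedRedPath : (m : ℕ) → (Fin (suc (suc m)) → Fin n) → Fin n → Set
  OnExtendedRedPath m p x =
      (∃[ i ] x ≡ p i)
    ⊎ (deg (p zero) ≡ 2 × Adj (p zero) x × x ≢ p (suc zero))
    ⊎ (deg (p (fromℕ (suc m))) ≡ 2 × Adj (p (fromℕ (suc m))) x
        × x ≢ p (inject₁ (fromℕ m)))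

  Branch : Fin n → Set
  Branch w = deg w > 2

  -- admissible choice of the vertex v in the no-red-edge case:
  -- its closed neighbourhood contains all branch vertices
  Centre : Fin n → Set
  Centre c = ∀ w → Branch w → w ≡ c ⊎ Adj c w

  -- red vertices (c is the fixed centre used when there is no red edge)
  Red : Fin n → Fin n → Set
  Red c x =
      (∃[ m ] ∃[ p ] RedPath m p × OnExtendedRedPath m p x)
    ⊎ (NoRedEdge × (x ≡ c ⊎ (deg c ≡ 2 × Adj c x)))

-- Geometry. The square of v is [X v, X v + 1] × [Y v, Y v + 1].
OnLine1 : ℚ → Set
OnLine1 y = y ≤ 1ℚ × 1ℚ ≤ y +ℚ 1ℚ

OnLine2 : ℚ → ℚ → Set
OnLine2 ε y = y ≤ (1ℚ +ℚ 1ℚ +ℚ ε) × (1ℚ +ℚ 1ℚ +ℚ ε) ≤ y +ℚ 1ℚ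

IntervalsMeet : ℚ → ℚ → Set
IntervalsMeet a b = a ≤ b +ℚ 1ℚ × b ≤ a +ℚ 1ℚ

record Rep2SUIG (ε : ℚ) {n : ℕ} (E : Graph n) : Set where
  field
    X Y   : Fin n → ℚ
    stab  : ∀ v → OnLine1 (Y v) ⊎ OnLine2 ε (Y v)
    adj→  : ∀ u v → Adj E u v → u ≢ v × IntervalsMeet (X u) (X v) × IntervalsMeet (Y u) (Y v)
    adj←  : ∀ u v → u ≢ v → IntervalsMeet (X u) (X v) → IntervalsMeet (Y u) (Y v) → Adj E u v

DifferentLines : {ε : ℚ} {n : ℕ} {E : Graph n} → Rep2SUIG ε E → Fin n → Fin n → Set
DifferentLines {ε} R u v =
    (OnLine1 (Y u) × OnLine2 ε (Y v)) ⊎ (OnLine2 ε (Y u) × OnLine1 (Y v))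
  where open Rep2SUIG R

-- Split the neighbours of a vertex z into four quadrants by the side of z's square
-- on which their squares lie, horizontally and vertically. Two squares meeting z's
-- square on the same side intersect each other, so two neighbours in one quadrant
-- would close a triangle. Hence if z has degree 4, some other neighbour b shares
-- the column of any given neighbour v: the three others cannot all lie in the
-- opposite column, which has only two quadrants. The squares of b and v meet
-- horizontally but are not adjacent, so they are vertically disjoint.
-- Let u, v be adjacent of degree 4 with Y u ≤ Y v. Such a b next to u has
-- Y b ≤ Y u + 1 ≤ Y v + 1, so disjointness gives Y v > Y b + 1 ≥ 1 and v is off
-- the line y = 1. Symmetrically such a t next to v has Y t ≥ Y v - 1 ≥ Y u - 1,
-- so Y u + 1 < Y t ≤ 2 + ε and u is off the line y = 2 + ε.
module Submission where

open import Defs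
open import Data.Nat using (ℕ; zero; suc; _+_)
open import Data.Nat.Properties using (suc-injective; +-suc)
open import Data.Fin using (Fin; zero; suc; inject₁)
open import Data.Fin.Properties using (_≟_)
open import Data.Bool using (Bool; true; false; if_then_else_; not)
open import Data.Bool.Properties using (¬-not) renaming (_≟_ to _≟ᵇ_)
open import Data.List using (tabulate)
open import Data.List.Properties using (map-tabulate)
open import Data.Nat.ListAction using (sum)
open import Data.Product using (∃-syntax; _×_; _,_; proj₁; proj₂; swap)
open import Data.Sum using (_⊎_; inj₁; inj₂)
open import Data.Empty using (⊥; ⊥-elim)
open import Data.Unit using (tt)
open import Function using (_∘_; id)
open import Relation.Nullary using (¬_; Dec; yes; no; does)
open import Relation.Nullary.Decidable using (dec-true; toWitness)
open import Relation.Binary.PropositionalEquality using (_≡_; _≢_; refl; sym; trans; cong)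
open import Data.Rational using (ℚ; 0ℚ; 1ℚ; _≤_; _<_; _≤?_) renaming (_+_ to _+ℚ_)
open import Data.Rational.Properties
  using (≤-trans; <-≤-trans; ≤-<-trans; <⇒≤; ≰⇒>; +-monoˡ-≤; +-monoʳ-≤; ≤-total; <-irrefl;
         +-identityʳ; module ≤-Reasoning)

count : ∀ {n} → (Fin n → Bool) → ℕ
count f = sum (tabulate (λ w → if f w then 1 else 0))

deg≡count : ∀ {n} (E : Graph n) u → deg E u ≡ count (E u)
deg≡count E u = cong sum (map-tabulate id (λ w → if E u w then 1 else 0))

infixl 6 _∖_

_∖_ : ∀ {n} → (Fin n → Bool) → Fin n → Fin n → Bool
(f ∖ x) w = if does (w ≟ x) then false else f w

count-∖ : ∀ {n} (f : Fin n → Bool) x → f x ≡ true → count f ≡ suc (count (f ∖ x))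
count-∖ f zero fx rewrite fx = refl
count-∖ {suc n} f (suc x) fx =
  trans (cong ((if f zero then 1 else 0) +_) (count-∖ (f ∘ suc) x fx)) (+-suc _ _)

count≡suc⇒∃ : ∀ {n} (f : Fin n → Bool) {k} → count f ≡ suc k → ∃[ y ] f y ≡ true
count≡suc⇒∃ {suc n} f eq with f zero in fzero
... | true  = zero , fzero
... | false = let (y , fy) = count≡suc⇒∃ (f ∘ suc) eq in suc y , fy

count≡suc⇒remove : ∀ {n} (f : Fin n → Bool) {k} → count f ≡ suc k →
  ∃[ y ] f y ≡ true × count (f ∖ y) ≡ k
count≡suc⇒remove f eq =
  let (y , fy) = count≡suc⇒∃ f eq in y , fy , suc-injective (trans (sym (count-∖ f y fy)) eq)

∖-true : ∀ {n} (f : Fin n → Bool) x y → (f ∖ x) y ≡ true → f y ≡ true × y ≢ x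
∖-true f x y eq with y ≟ x
... | no y≢x = eq , y≢x

record ThreeOtherNeighbours {n} (E : Graph n) (u v : Fin n) : Set where
  field
    a₁ a₂ a₃ : Fin n
    adj₁ : Adj E u a₁
    adj₂ : Adj E u a₂
    adj₃ : Adj E u a₃
    a₁≢v : a₁ ≢ v
    a₂≢v : a₂ ≢ v
    a₃≢v : a₃ ≢ v
    a₁≢a₂ : a₁ ≢ a₂
    a₁≢a₃ : a₁ ≢ a₃
    a₂≢a₃ : a₂ ≢ a₃

deg≡4⇒threeOtherNeighbours : ∀ {n} (E : Graph n) {u v} → Adj E u v → deg E u ≡ 4 →
  ThreeOtherNeighbours E u v
deg≡4⇒threeOtherNeighbours E {u} {v} uv deg≡4
  with a₁ , f₀a₁ , count₁ ← count≡suc⇒remove (E u ∖ v)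
         (suc-injective (trans (sym (count-∖ (E u) v uv)) (trans (sym (deg≡count E u)) deg≡4)))
  with a₂ , f₁a₂ , count₂ ← count≡suc⇒remove (E u ∖ v ∖ a₁) count₁
  with a₃ , f₂a₃ , _      ← count≡suc⇒remove (E u ∖ v ∖ a₁ ∖ a₂) count₂
  with adj₁ , a₁≢v  ← ∖-true (E u) v a₁ f₀a₁
  with f₀a₂ , a₂≢a₁ ← ∖-true (E u ∖ v) a₁ a₂ f₁a₂
  with adj₂ , a₂≢v  ← ∖-true (E u) v a₂ f₀a₂
  with f₁a₃ , a₃≢a₂ ← ∖-true (E u ∖ v ∖ a₁) a₂ a₃ f₂a₃
  with f₀a₃ , a₃≢a₁ ← ∖-true (E u ∖ v) a₁ a₃ f₁a₃
  with adj₃ , a₃≢v  ← ∖-true (E u) v a₃ f₀a₃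
  = record
  { a₁ = a₁ ; a₂ = a₂ ; a₃ = a₃
  ; adj₁ = adj₁ ; adj₂ = adj₂ ; adj₃ = adj₃
  ; a₁≢v = a₁≢v ; a₂≢v = a₂≢v ; a₃≢v = a₃≢v
  ; a₁≢a₂ = a₂≢a₁ ∘ sym ; a₁≢a₃ = a₃≢a₁ ∘ sym ; a₂≢a₃ = a₃≢a₂ ∘ sym
  }

triangle⇒cycle : ∀ {n} (E : Graph n) {x y z} → x ≢ y → x ≢ z → y ≢ z →
  Adj E x y → Adj E y z → Adj E z x → Cycle E
triangle⇒cycle {n} E {x} {y} {z} x≢y x≢z y≢z xy yz zx = 0 , c , c-injective , path , zx
  where
  c : Fin 3 → Fin n
  c zero             = x
  c (suc zero)       = y
  c (suc (suc zero)) = z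
  c-injective : ∀ {i j} → c i ≡ c j → i ≡ j
  c-injective {zero}             {zero}             _ = refl
  c-injective {zero}             {suc zero}         p = ⊥-elim (x≢y p)
  c-injective {zero}             {suc (suc zero)}   p = ⊥-elim (x≢z p)
  c-injective {suc zero}         {zero}             p = ⊥-elim (x≢y (sym p))
  c-injective {suc zero}         {suc zero}         _ = refl
  c-injective {suc zero}         {suc (suc zero)}   p = ⊥-elim (y≢z p)
  c-injective {suc (suc zero)}   {zero}             p = ⊥-elim (x≢z (sym p))
  c-injective {suc (suc zero)}   {suc zero}         p = ⊥-elim (y≢z (sym p))
  c-injective {suc (suc zero)}   {suc (suc zero)}   _ = refl
  path : ∀ (i : Fin 2) → Adj E (c (inject₁ i)) (c (suc i))
  path zero       = xy
  path (suc zero) = yz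

Bool-pigeonhole : (x y z : Bool) → x ≡ y ⊎ x ≡ z ⊎ y ≡ z
Bool-pigeonhole true  true  _     = inj₁ refl
Bool-pigeonhole false false _     = inj₁ refl
Bool-pigeonhole true  false true  = inj₂ (inj₁ refl)
Bool-pigeonhole true  false false = inj₂ (inj₂ refl)
Bool-pigeonhole false true  true  = inj₂ (inj₂ refl)
Bool-pigeonhole false true  false = inj₂ (inj₁ refl)

same-does⇒→ : ∀ {A B : Set} (a? : Dec A) (b? : Dec B) → does a? ≡ does b? → A → B
same-does⇒→ a? (yes b) _    _ = b
same-does⇒→ a? (no _)  same a with () ← trans (sym (dec-true a? a)) same

same-side⇒IntervalsMeet : ∀ {z a b} → IntervalsMeet z a → IntervalsMeet z b →
  does (z ≤? a) ≡ does (z ≤? b) → IntervalsMeet a b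
same-side⇒IntervalsMeet {z} {a} {b} (z≤a+1 , a≤z+1) (z≤b+1 , b≤z+1) same with z ≤? a | z ≤? b
... | yes z≤a | yes z≤b = ≤-trans a≤z+1 (+-monoˡ-≤ 1ℚ z≤b) , ≤-trans b≤z+1 (+-monoˡ-≤ 1ℚ z≤a)
... | no  z≰a | no  z≰b = <⇒≤ (<-≤-trans (≰⇒> z≰a) z≤b+1) , <⇒≤ (<-≤-trans (≰⇒> z≰b) z≤a+1)
... | yes z≤a | no  z≰b = ⊥-elim (z≰b (same-does⇒→ (z ≤? a) (z ≤? b) same z≤a))
... | no  z≰a | yes z≤b = ⊥-elim (z≰a (same-does⇒→ (z ≤? b) (z ≤? a) (sym same) z≤b))

¬IntervalsMeet⇒gap : ∀ {a b} → a ≤ b +ℚ 1ℚ → ¬ IntervalsMeet a b → a +ℚ 1ℚ < b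
¬IntervalsMeet⇒gap a≤b+1 ¬meet = ≰⇒> (λ b≤a+1 → ¬meet (a≤b+1 , b≤a+1))

1≤2+ε : ∀ {ε} → 0ℚ ≤ ε → 1ℚ ≤ 1ℚ +ℚ 1ℚ +ℚ ε
1≤2+ε {ε} 0≤ε = begin
  1ℚ               ≤⟨ toWitness {a? = 1ℚ ≤? 1ℚ +ℚ 1ℚ} tt ⟩
  1ℚ +ℚ 1ℚ         ≡⟨ sym (+-identityʳ (1ℚ +ℚ 1ℚ)) ⟩
  1ℚ +ℚ 1ℚ +ℚ 0ℚ   ≤⟨ +-monoʳ-≤ (1ℚ +ℚ 1ℚ) 0≤ε ⟩
  1ℚ +ℚ 1ℚ +ℚ ε    ∎
  where open ≤-Reasoning

module _ {ε : ℚ} {n : ℕ} {E : Graph n} (R : Rep2SUIG ε E) where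
  open Rep2SUIG R

  Adj⇒≢ : ∀ {a b} → Adj E a b → a ≢ b
  Adj⇒≢ {a} {b} ab = proj₁ (adj→ a b ab)

  Adj⇒X-meet : ∀ {a b} → Adj E a b → IntervalsMeet (X a) (X b)
  Adj⇒X-meet {a} {b} ab = proj₁ (proj₂ (adj→ a b ab))

  Adj⇒Y-meet : ∀ {a b} → Adj E a b → IntervalsMeet (Y a) (Y b)
  Adj⇒Y-meet {a} {b} ab = proj₂ (proj₂ (adj→ a b ab))

  Adj-sym : ∀ {a b} → Adj E a b → Adj E b a
  Adj-sym {a} {b} ab =
    adj← b a (Adj⇒≢ ab ∘ sym) (swap (Adj⇒X-meet ab)) (swap (Adj⇒Y-meet ab))

  acyclic⇒triangle-free : ¬ Cycle E → ∀ {z a b} → Adj E z a → Adj E z b → ¬ Adj E a b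
  acyclic⇒triangle-free acyclic za zb ab =
    acyclic (triangle⇒cycle E (Adj⇒≢ za) (Adj⇒≢ zb) (Adj⇒≢ ab) za ab (Adj-sym zb))

  module _ (acyclic : ¬ Cycle E) {z : Fin n} where

    column : Fin n → Bool
    column w = does (X z ≤? X w)

    row : Fin n → Bool
    row w = does (Y z ≤? Y w)

    same-quadrant⇒≡ : ∀ {w w'} → Adj E z w → Adj E z w' →
      column w ≡ column w' → row w ≡ row w' → w ≡ w'
    same-quadrant⇒≡ {w} {w'} zw zw' same-column same-row with w ≟ w'
    ... | yes w≡w' = w≡w'
    ... | no  w≢w' = ⊥-elim (acyclic⇒triangle-free acyclic zw zw' (adj← w w' w≢w'
            (same-side⇒IntervalsMeet (Adj⇒X-meet zw) (Adj⇒X-meet zw') same-column)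
            (same-side⇒IntervalsMeet (Adj⇒Y-meet zw) (Adj⇒Y-meet zw') same-row)))

    ColumnMate : Fin n → Set
    ColumnMate v = ∃[ b ] Adj E z b × b ≢ v × column b ≡ column v

    deg≡4⇒columnMate : ∀ {v} → Adj E z v → deg E z ≡ 4 → ColumnMate v
    deg≡4⇒columnMate {v} zv deg≡4 =
      among (mate-or-opposite adj₁ a₁≢v) (mate-or-opposite adj₂ a₂≢v) (mate-or-opposite adj₃ a₃≢v)
      where
      open ThreeOtherNeighbours (deg≡4⇒threeOtherNeighbours E zv deg≡4)

      mate-or-opposite : ∀ {a} → Adj E z a → a ≢ v → ColumnMate v ⊎ column a ≡ not (column v)
      mate-or-opposite {a} za a≢v with column a ≟ᵇ column v
      ... | yes same   = inj₁ (a , za , a≢v , same)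
      ... | no  differ = inj₂ (¬-not differ)

      among : ColumnMate v ⊎ column a₁ ≡ not (column v) →
              ColumnMate v ⊎ column a₂ ≡ not (column v) →
              ColumnMate v ⊎ column a₃ ≡ not (column v) → ColumnMate v
      among (inj₁ m)  _        _        = m
      among (inj₂ _)  (inj₁ m) _        = m
      among (inj₂ _)  (inj₂ _) (inj₁ m) = m
      among (inj₂ c₁) (inj₂ c₂) (inj₂ c₃) =
        ⊥-elim (two-share-a-row (Bool-pigeonhole (row a₁) (row a₂) (row a₃)))
        where
        two-share-a-row : row a₁ ≡ row a₂ ⊎ row a₁ ≡ row a₃ ⊎ row a₂ ≡ row a₃ → ⊥
        two-share-a-row (inj₁ r₁₂)        = a₁≢a₂ (same-quadrant⇒≡ adj₁ adj₂ (trans c₁ (sym c₂)) r₁₂)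
        two-share-a-row (inj₂ (inj₁ r₁₃)) = a₁≢a₃ (same-quadrant⇒≡ adj₁ adj₃ (trans c₁ (sym c₃)) r₁₃)
        two-share-a-row (inj₂ (inj₂ r₂₃)) = a₂≢a₃ (same-quadrant⇒≡ adj₂ adj₃ (trans c₂ (sym c₃)) r₂₃)

    deg≡4⇒Y-disjoint-neighbour : ∀ {v} → Adj E z v → deg E z ≡ 4 →
      ∃[ b ] Adj E z b × ¬ IntervalsMeet (Y b) (Y v)
    deg≡4⇒Y-disjoint-neighbour {v} zv deg≡4 =
      let b , zb , b≢v , same = deg≡4⇒columnMate zv deg≡4 in
      b , zb , λ Y-meet → acyclic⇒triangle-free acyclic zb zv
        (adj← b v b≢v (same-side⇒IntervalsMeet (Adj⇒X-meet zb) (Adj⇒X-meet zv) same) Y-meet)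

  module _ (0≤ε : 0ℚ ≤ ε) where

    1≤Y+1 : ∀ w → 1ℚ ≤ Y w +ℚ 1ℚ
    1≤Y+1 w with stab w
    ... | inj₁ (_ , 1≤Y+1)   = 1≤Y+1
    ... | inj₂ (_ , 2+ε≤Y+1) = ≤-trans (1≤2+ε 0≤ε) 2+ε≤Y+1

    Y≤2+ε : ∀ w → Y w ≤ 1ℚ +ℚ 1ℚ +ℚ ε
    Y≤2+ε w with stab w
    ... | inj₁ (Y≤1 , _)   = ≤-trans Y≤1 (1≤2+ε 0≤ε)
    ... | inj₂ (Y≤2+ε , _) = Y≤2+ε

  module _ (acyclic : ¬ Cycle E) (0≤ε : 0ℚ ≤ ε) where

    module _ {u v : Fin n} (uv : Adj E u v) (Yu≤Yv : Y u ≤ Y v) where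

      deg≡4⇒upper-neighbour-above-line₁ : deg E u ≡ 4 → 1ℚ < Y v
      deg≡4⇒upper-neighbour-above-line₁ deg≡4 =
        let b , ub , disjoint = deg≡4⇒Y-disjoint-neighbour acyclic uv deg≡4 in
        ≤-<-trans (1≤Y+1 0≤ε b)
          (¬IntervalsMeet⇒gap (≤-trans (proj₂ (Adj⇒Y-meet ub)) (+-monoˡ-≤ 1ℚ Yu≤Yv)) disjoint)

      deg≡4⇒lower-neighbour-below-line₂ : deg E v ≡ 4 → Y u +ℚ 1ℚ < 1ℚ +ℚ 1ℚ +ℚ ε
      deg≡4⇒lower-neighbour-below-line₂ deg≡4 =
        let t , vt , disjoint = deg≡4⇒Y-disjoint-neighbour acyclic (Adj-sym uv) deg≡4 in
        <-≤-trans
          (¬IntervalsMeet⇒gap (≤-trans Yu≤Yv (proj₁ (Adj⇒Y-meet vt))) (disjoint ∘ swap))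
          (Y≤2+ε 0≤ε t)

      deg≡4⇒lower-on-line₁-upper-on-line₂ : deg E u ≡ 4 → deg E v ≡ 4 →
        OnLine1 (Y u) × OnLine2 ε (Y v)
      deg≡4⇒lower-on-line₁-upper-on-line₂ deg-u deg-v with stab u | stab v
      ... | inj₁ on₁ | inj₂ on₂ = on₁ , on₂
      ... | inj₂ (_ , 2+ε≤Yu+1) | _ =
        ⊥-elim (<-irrefl refl (<-≤-trans (deg≡4⇒lower-neighbour-below-line₂ deg-v) 2+ε≤Yu+1))
      ... | inj₁ _ | inj₁ (Yv≤1 , _) =
        ⊥-elim (<-irrefl refl (<-≤-trans (deg≡4⇒upper-neighbour-above-line₁ deg-u) Yv≤1))

    adjacent-deg≡4⇒DifferentLines : ∀ {u v} → Adj E u v → deg E u ≡ 4 → deg E v ≡ 4 →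
      DifferentLines R u v
    adjacent-deg≡4⇒DifferentLines {u} {v} uv deg-u deg-v with ≤-total (Y u) (Y v)
    ... | inj₁ Yu≤Yv = inj₁ (deg≡4⇒lower-on-line₁-upper-on-line₂ uv Yu≤Yv deg-u deg-v)
    ... | inj₂ Yv≤Yu =
      inj₂ (swap (deg≡4⇒lower-on-line₁-upper-on-line₂ (Adj-sym uv) Yv≤Yu deg-v deg-u))

lemma13 : (ε : ℚ) → 0ℚ < ε → ε < 1ℚ →
    (n : ℕ) (E : Graph n) → IsTree E → (R : Rep2SUIG ε E) →
    (c : Fin n) → (NoRedEdge E → Centre E c) →
    (u v : Fin n) → Red E c u → Red E c v → Adj E u v →
    deg E u ≡ 4 → deg E v ≡ 4 → DifferentLines R u v
lemma13 _ 0<ε _ _ _ (_ , acyclic) R _ _ _ _ _ _ =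
  adjacent-deg≡4⇒DifferentLines R acyclic (<⇒≤ 0<ε)
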